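{- Let $P$ be a finite poset with a minimum element $\hat{0}$, let $m$ be a positive integer, and let $T$ be the trunk of $P$, with $t=\#T$. Set $P'=P-T$ (with the induced order) and $m'=m-t$. Then the action of $\partial_K$ on $\mathcal{L}_m(P)$ is equivariant to the action of $\partial_K$ on $\mathcal{L}_{m'}(P')$; that is, there is a bijection $\phi:\mathcal{L}_m(P)\to\mathcal{L}_{m'}(P')$ with $\partial_K\circ\phi=\phi\circ\partial_K$.
   Context: For a positive integer $m$, $[m]=\{1,\dots,m\}$. An $m$-packed labeling of a finite poset $P$ is a surjection $L:P\to[m]$ such that $x<_P y$ implies $L(x)<L(y)$; $\mathcal{L}_m(P)$ is the set of all of them (possibly empty). $K$-promotion $\partial_K:\mathcal{L}_m(P)\to\mathcal{L}_m(P)$ is defined as follows. Given $L$, erase the labels of all elements labeled $1$. Then for $i=2,3,\dots,m$ in turn: for every cover relation $x\lessdot y$ such that $x$ is currently unlabeled and $y$ currently has label $i$, give $x$ the label $i$ and erase the label of $y$ (all such pairs are processed simultaneously; other elements are unchanged). Finally decrease every existing label by $1$ and give the label $m$ to every unlabeled element. This is a bijection of $\mathcal{L}_m(P)$. The trunk of a poset $P$ with minimum $\hat{0}$ is the longest chain $\hat{0}=x_1\lessdot x_2\lessdot\cdots\lessdot x_t$ starting at $\hat 0$ such that each $x_i$ is covered by exactly one element of $P$ (it is empty if $\hat0$ is not covered by exactly one element). -}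

module Defs where

open import Data.Nat using (ℕ; zero; suc; _≤_; _<_; _∸_; _≟_)
open import Data.Fin using (Fin)
open import Data.Fin.Properties using (any?) renaming (_≟_ to _≟ᶠ_)
open import Data.Vec using (Vec; lookup; tabulate)
open import Data.List using (List; []; _∷_; length; foldl; applyUpTo)
open import Data.List.Membership.Propositional using (_∈_)
open import Data.Product using (Σ; ∃; _×_; _,_; proj₁; proj₂)
open import Data.Product.Properties using ()
open import Relation.Nullary using (¬_; Dec; yes; no)
open import Relation.Nullary.Decidable using (_×-dec_; ¬?; ⌊_⌋)
open import Relation.Binary.PropositionalEquality using (_≡_; _≢_; refl; sym; trans; cong)
open import Data.Bool using (Bool; if_then_else_; _∧_)

record FinPoset (n : ℕ) : Set₁ where
  field
    _≤P_    : Fin n → Fin n → Set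
    ≤P?     : (x y : Fin n) → Dec (x ≤P y)
    reflP   : ∀ x → x ≤P x
    antisymP : ∀ {x y} → x ≤P y → y ≤P x → x ≡ y
    transP  : ∀ {x y z} → x ≤P y → y ≤P z → x ≤P z

module _ {n : ℕ} (P : FinPoset n) where
  open FinPoset P

  _<P_ : Fin n → Fin n → Set
  x <P y = x ≤P y × x ≢ y

  <P? : (x y : Fin n) → Dec (x <P y)
  <P? x y = ≤P? x y ×-dec ¬? (x ≟ᶠ y)

  _⋖_ : Fin n → Fin n → Set
  x ⋖ y = x <P y × ¬ (∃ λ z → x <P z × z <P y)

  ⋖? : (x y : Fin n) → Dec (x ⋖ y)
  ⋖? x y = <P? x y ×-dec ¬? (any? (λ z → <P? x z ×-dec <P? z y))

  IsMinimum : Fin n → Set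
  IsMinimum z = ∀ x → z ≤P x

  CoveredByExactlyOne : Fin n → Set
  CoveredByExactlyOne x = ∃ λ y → x ⋖ y × (∀ z → x ⋖ z → z ≡ y)

  private
    Chain : List (Fin n) → Set
    Chain [] = Data.Unit.⊤ where import Data.Unit
    Chain (x ∷ []) = CoveredByExactlyOne x
    Chain (x ∷ y ∷ xs) = CoveredByExactlyOne x × x ⋖ y × Chain (y ∷ xs)

  TrunkCandidate : Fin n → List (Fin n) → Set
  TrunkCandidate z0 [] = Data.Unit.⊤ where import Data.Unit
  TrunkCandidate z0 (x ∷ xs) = x ≡ z0 × Chain (x ∷ xs)

  IsTrunk : Fin n → List (Fin n) → Set
  IsTrunk z0 T = TrunkCandidate z0 T × (∀ U → TrunkCandidate z0 U → length U ≤ length T)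

  IsPacked : ℕ → Vec ℕ n → Set
  IsPacked m L =
      (∀ x → 1 ≤ lookup L x × lookup L x ≤ m)
    × (∀ k → 1 ≤ k → k ≤ m → ∃ λ x → lookup L x ≡ k)
    × (∀ x y → x <P y → lookup L x < lookup L y)

  -- K-promotion.  Intermediate states: label 0 encodes "unlabeled".
  private
    eqb : ℕ → ℕ → Bool
    eqb a b = ⌊ a ≟ b ⌋

    -- one step for label i, all cover pairs processed simultaneously
    step : (Fin n → ℕ) → ℕ → (Fin n → ℕ)
    step s i x =
      if eqb (s x) 0 ∧ ⌊ any? (λ y → ⋖? x y ×-dec (s y ≟ i)) ⌋ then i
      else if eqb (s x) i ∧ ⌊ any? (λ w → ⋖? w x ×-dec (s w ≟ 0)) ⌋ then 0
      else s x

  ∂K : ℕ → Vec ℕ n → Vec ℕ n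
  ∂K m L = tabulate final
    where
      s₀ : Fin n → ℕ
      s₀ x = if eqb (lookup L x) 1 then 0 else lookup L x
      -- i = 2, 3, …, m
      sₘ : Fin n → ℕ
      sₘ = foldl step s₀ (applyUpTo (λ j → suc (suc j)) (m ∸ 1))
      final : Fin n → ℕ
      final x = if eqb (sₘ x) 0 then m else sₘ x ∸ 1

induced : ∀ {n n'} → FinPoset n → (e : Fin n' → Fin n) →
          (∀ {x y} → e x ≡ e y → x ≡ y) → FinPoset n'
induced P e inj = record
  { _≤P_ = λ x y → e x ≤P e y
  ; ≤P? = λ x y → ≤P? (e x) (e y)
  ; reflP = λ x → reflP (e x)
  ; antisymP = λ p q → inj (antisymP p q)
  ; transP = transP
  }
  where open FinPoset P

module Submission where

-- Every m-packed labeling of P labels the trunk 1, …, t from the bottom and everything else above t,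
-- so subtracting t is a bijection onto the (m - t)-packed labelings of P' = P - T. In K-promotion on P
-- the steps for the labels 2, …, t + 1 only pass the vacancy up the trunk, each trunk element taking
-- the label of its unique cover, and end with the elements labeled t + 1 vacated, which is exactly
-- where promotion on P' starts. From then on the trunk keeps labels in 2, …, t + 1 and P' is an
-- up-set, so the two promotions run in lockstep with labels offset by t.

open import Defs
open import Data.Bool using (Bool; true; false; if_then_else_; _∧_)
open import Data.Bool.Properties using (if-float)
open import Data.Fin using (Fin)
open import Data.Fin.Induction using (po-wellFounded)
open import Data.Fin.Properties using (any?) renaming (_≟_ to _≟ᶠ_)
open import Data.List using (List; []; _∷_; length; foldl; applyUpTo)
open import Data.List.Membership.Propositional using (_∈_; _∉_)
open import Data.List.Relation.Unary.Any using (here; there)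
open import Data.Nat using (ℕ; zero; suc; _+_; _∸_; _≤_; _<_; _≰_; _≟_; _≤?_; z≤n; s≤s)
open import Data.Nat.Properties
open import Data.Product using (Σ; ∃; _×_; _,_; proj₁; proj₂)
open import Data.Sum using (_⊎_; inj₁; inj₂)
open import Data.Vec using (Vec; lookup; tabulate)
open import Data.Vec.Properties using (lookup∘tabulate; tabulate-cong)
open import Data.Vec.Relation.Binary.Pointwise.Extensional using (ext; Pointwise-≡⇒≡)
open import Function.Base using (_∘_)
open import Function.Bundles using (_⇔_; mk⇔)
open import Induction.WellFounded using (Acc; acc)
open import Level using (Level)
import Relation.Binary.Construct.NonStrictToStrict as ToStrict
open import Relation.Binary.Definitions using (tri<; tri≈; tri>)
open import Relation.Binary.PropositionalEquality
  using (_≡_; _≢_; refl; sym; trans; cong; cong₂; subst; subst₂; isEquivalence; module ≡-Reasoning)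
open import Relation.Binary.Structures using (IsPartialOrder)
open import Relation.Nullary using (¬_; Dec; yes; no)
open import Relation.Nullary.Decidable
  using (⌊_⌋; _×-dec_; isYes≗does; dec-true; dec-false; does-⇔)
open import Relation.Nullary.Negation using (contradiction)

module _ {a : Level} {A : Set a} where

  ⌊⌋-true : (a? : Dec A) → A → ⌊ a? ⌋ ≡ true
  ⌊⌋-true a? x = trans (isYes≗does a?) (dec-true a? x)

  ⌊⌋-false : (a? : Dec A) → ¬ A → ⌊ a? ⌋ ≡ false
  ⌊⌋-false a? ¬x = trans (isYes≗does a?) (dec-false a? ¬x)

  ⌊⌋-⇔ : ∀ {b} {B : Set b} → A ⇔ B → (a? : Dec A) (b? : Dec B) → ⌊ a? ⌋ ≡ ⌊ b? ⌋
  ⌊⌋-⇔ A⇔B a? b? = trans (isYes≗does a?) (trans (does-⇔ A⇔B a? b?) (sym (isYes≗does b?)))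

-- In the states of K-promotion 0 stands for "unlabeled"; these are the pointwise operations of ∂K.

erase-one : ℕ → ℕ
erase-one v = if ⌊ v ≟ 1 ⌋ then 0 else v

slide : (v i : ℕ) (fill vacate : Bool) → ℕ
slide v i fill vacate = if ⌊ v ≟ 0 ⌋ ∧ fill then i else if ⌊ v ≟ i ⌋ ∧ vacate then 0 else v

finish : ℕ → ℕ → ℕ
finish m v = if ⌊ v ≟ 0 ⌋ then m else v ∸ 1

shift : ℕ → ℕ → ℕ
shift t zero = zero
shift t (suc v) = suc v + t

slide-keep : ∀ {v i fill vacate} → v ≢ 0 → v ≢ i → slide v i fill vacate ≡ v
slide-keep {v} {i} {fill} {vacate} v≢0 v≢i =
  cong₂ (λ a b → if a ∧ fill then i else if b ∧ vacate then 0 else v)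
        (⌊⌋-false (v ≟ 0) v≢0) (⌊⌋-false (v ≟ i) v≢i)

slide-vacate : ∀ {i fill} → i ≢ 0 → slide i i fill true ≡ 0
slide-vacate {i} {fill} i≢0 =
  cong₂ (λ a b → if a ∧ fill then i else if b ∧ true then 0 else i)
        (⌊⌋-false (i ≟ 0) i≢0) (⌊⌋-true (i ≟ i) refl)

slide-shift : ∀ t v i fill vacate →
              slide (shift t v) (suc i + t) fill vacate ≡ shift t (slide v (suc i) fill vacate)
slide-shift t zero i false vacate = refl
slide-shift t zero i true vacate = refl
slide-shift t (suc v) i fill vacate = begin
  (if ⌊ suc v + t ≟ suc i + t ⌋ ∧ vacate then 0 else suc v + t)
    ≡⟨ cong (λ b → if b ∧ vacate then 0 else suc v + t)
            (⌊⌋-⇔ (mk⇔ (+-cancelʳ-≡ t (suc v) (suc i)) (cong (_+ t))) _ _) ⟩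
  (if ⌊ suc v ≟ suc i ⌋ ∧ vacate then 0 else suc v + t)
    ≡⟨ if-float (shift t) (⌊ suc v ≟ suc i ⌋ ∧ vacate) ⟨
  shift t (if ⌊ suc v ≟ suc i ⌋ ∧ vacate then 0 else suc v) ∎
  where open ≡-Reasoning

finish-shift : ∀ m t v → finish (m ∸ t) v ≡ finish m (shift t v) ∸ t
finish-shift m t zero = refl
finish-shift m t (suc v) = sym (m+n∸n≡m v t)

shift≡0 : ∀ {t} v → shift t v ≡ 0 → v ≡ 0
shift≡0 zero _ = refl

shift≡+ : ∀ {t} v i → shift t v ≡ suc i + t → v ≡ suc i
shift≡+ {t} (suc v) i eq = +-cancelʳ-≡ t (suc v) (suc i) eq

module Order {n : ℕ} (P : FinPoset n) where
  open FinPoset P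

  ≤P-isPartialOrder : IsPartialOrder _≡_ _≤P_
  ≤P-isPartialOrder = record
    { isPreorder = record
      { isEquivalence = isEquivalence
      ; reflexive = λ { refl → reflP _ }
      ; trans = transP
      }
    ; antisym = antisymP
    }

  <P-trans : ∀ {x y z} → _<P_ P x y → _<P_ P y z → _<P_ P x z
  <P-trans = ToStrict.<-trans _≡_ _≤P_ ≤P-isPartialOrder

  ≤P-<P-trans : ∀ {x y z} → x ≤P y → _<P_ P y z → _<P_ P x z
  ≤P-<P-trans = ToStrict.≤-<-trans _≡_ _≤P_ transP antisymP (λ { refl p → p })

  ≤P⇒≡⊎<P : ∀ {x y} → x ≤P y → x ≡ y ⊎ _<P_ P x y
  ≤P⇒≡⊎<P {x} {y} x≤y with x ≟ᶠ y
  ... | yes x≡y = inj₁ x≡y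
  ... | no x≢y = inj₂ (x≤y , x≢y)

  cover-below : ∀ {x z} → _<P_ P x z → ∃ λ w → _⋖_ P x w × w ≤P z
  cover-below {x} {z} x<z = go (po-wellFounded ≤P-isPartialOrder z) x<z
    where
    go : ∀ {z} → Acc (_<P_ P) z → _<P_ P x z → ∃ λ w → _⋖_ P x w × w ≤P z
    go {z} (acc below) x<z with any? (λ u → <P? P x u ×-dec <P? P u z)
    ... | no nothing-between = z , (x<z , nothing-between) , reflP z
    ... | yes (u , x<u , u<z) with go (below u<z) x<u
    ...   | w , x⋖w , w≤u = w , x⋖w , transP w≤u (proj₁ u<z)

module Promotion {n : ℕ} (P : FinPoset n) where

  step : (Fin n → ℕ) → ℕ → Fin n → ℕ
  step s i x = slide (s x) i ⌊ any? (λ y → ⋖? P x y ×-dec (s y ≟ i)) ⌋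
                             ⌊ any? (λ w → ⋖? P w x ×-dec (s w ≟ 0)) ⌋

  steps : (Fin n → ℕ) → ℕ → ℕ → Fin n → ℕ
  steps s i zero = s
  steps s i (suc k) = steps (step s i) (suc i) k

  initial : Vec ℕ n → Fin n → ℕ
  initial L x = erase-one (lookup L x)

  foldl-steps : ∀ (f : ℕ → ℕ) i k s → (∀ j → f j ≡ i + j) →
                foldl step s (applyUpTo f k) ≡ steps s i k
  foldl-steps f i zero s f≗i+ = refl
  foldl-steps f i (suc k) s f≗i+ =
    trans (cong (λ j → foldl step (step s j) (applyUpTo (f ∘ suc) k))
                (trans (f≗i+ 0) (+-identityʳ i)))
          (foldl-steps (f ∘ suc) (suc i) k (step s i) (λ j → trans (f≗i+ (suc j)) (+-suc i j)))

  ∂K-steps : ∀ m L → ∂K P m L ≡ tabulate (λ x → finish m (steps (initial L) 2 (m ∸ 1) x))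
  ∂K-steps m L = cong (λ s → tabulate (λ x → finish m (s x)))
                      (foldl-steps (λ j → suc (suc j)) 2 (m ∸ 1) (initial L) (λ j → refl))

  steps-+ : ∀ s i p q → steps s i (p + q) ≡ steps (steps s i p) (i + p) q
  steps-+ s i zero q = cong (λ j → steps s j q) (sym (+-identityʳ i))
  steps-+ s i (suc p) q =
    trans (steps-+ (step s i) (suc i) p q)
          (cong (λ j → steps (steps (step s i) (suc i) p) j q) (sym (+-suc i p)))

  step-fills : ∀ {s i x} → s x ≡ 0 → (∃ λ y → _⋖_ P x y × s y ≡ i) → step s i x ≡ i
  step-fills {s} {i} {x} sx≡0 up =
    cong₂ (λ v f → slide v i f ⌊ any? (λ w → ⋖? P w x ×-dec (s w ≟ 0)) ⌋)
          sx≡0 (⌊⌋-true (any? _) up)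

  step-vacates : ∀ {s i x} → i ≢ 0 → s x ≡ i → (∃ λ w → _⋖_ P w x × s w ≡ 0) →
                 step s i x ≡ 0
  step-vacates {s} {i} {x} i≢0 sx≡i down =
    trans (cong₂ (λ v d → slide v i ⌊ any? (λ y → ⋖? P x y ×-dec (s y ≟ i)) ⌋ d)
                 sx≡i (⌊⌋-true (any? _) down))
          (slide-vacate i≢0)

  step-keeps : ∀ {s i x} → s x ≢ 0 → s x ≢ i → step s i x ≡ s x
  step-keeps = slide-keep

-- The state, after the steps for the labels 2, …, i, of an element labeled ℓ, as long as every
-- label below i has slid along a cover.
Shifted : ℕ → ℕ → ℕ → Set
Shifted i ℓ v = (ℓ < i → v ≡ suc ℓ) × (ℓ ≡ i → v ≡ 0) × (i < ℓ → v ≡ ℓ)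

shifted-below : ∀ {i ℓ} → ℓ < i → Shifted i ℓ (suc ℓ)
shifted-below ℓ<i =
  (λ _ → refl) , (λ ℓ≡i → contradiction ℓ≡i (<⇒≢ ℓ<i)) , (λ i<ℓ → contradiction i<ℓ (<⇒≯ ℓ<i))

shifted-at : ∀ {i} → Shifted i i 0
shifted-at =
  (λ i<i → contradiction i<i (<-irrefl refl)) , (λ _ → refl) , (λ i<i → contradiction i<i (<-irrefl refl))

shifted-above : ∀ {i ℓ} → i < ℓ → Shifted i ℓ ℓ
shifted-above i<ℓ =
  (λ ℓ<i → contradiction ℓ<i (<⇒≯ i<ℓ)) , (λ ℓ≡i → contradiction (sym ℓ≡i) (<⇒≢ i<ℓ)) , (λ _ → refl)

module Sliding {n : ℕ} (P : FinPoset n) (L : Vec ℕ n) where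
  open Promotion P

  ShiftedUpTo : ℕ → (Fin n → ℕ) → Set
  ShiftedUpTo i s = ∀ x → Shifted i (lookup L x) (s x)

  Slides : ℕ → Set
  Slides i = (∀ x → lookup L x ≡ i → ∃ λ y → _⋖_ P x y × lookup L y ≡ suc i)
           × (∀ y → lookup L y ≡ suc i → ∃ λ w → _⋖_ P w y × lookup L w ≡ i)

  initial-shifted : (∀ x → 1 ≤ lookup L x) → ShiftedUpTo 1 (initial L)
  initial-shifted positive x with lookup L x | positive x
  ... | suc zero | _ = shifted-at
  ... | suc (suc ℓ) | _ = shifted-above (s≤s (s≤s z≤n))

  step-shifted : ∀ {i s} → Slides i → ShiftedUpTo i s → ShiftedUpTo (suc i) (step s (suc i))
  step-shifted {i} {s} (up , down) shifted x with <-cmp (lookup L x) (suc i)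
  ... | tri< ℓ<1+i _ _ = subst (Shifted (suc i) (lookup L x)) (sym moved-up) (shifted-below ℓ<1+i)
    where
    moved-up : step s (suc i) x ≡ suc (lookup L x)
    moved-up with m≤n⇒m<n∨m≡n (≤-pred ℓ<1+i)
    ... | inj₁ ℓ<i = trans (step-keeps {s} {suc i} {x} (λ sx≡0 → 1+n≢0 (trans (sym sx≡1+ℓ) sx≡0))
                                                       (<⇒≢ ℓ<i ∘ suc-injective ∘ trans (sym sx≡1+ℓ)))
                           sx≡1+ℓ
      where sx≡1+ℓ = proj₁ (shifted x) ℓ<i
    ... | inj₂ ℓ≡i with up x ℓ≡i
    ...   | y , x⋖y , ℓy≡1+i = trans (step-fills (proj₁ (proj₂ (shifted x)) ℓ≡i) (y , x⋖y , sy≡1+i))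
                                     (cong suc (sym ℓ≡i))
      where sy≡1+i = trans (proj₂ (proj₂ (shifted y)) (subst (i <_) (sym ℓy≡1+i) (n<1+n i))) ℓy≡1+i
  ... | tri≈ _ ℓ≡1+i _ = subst (Shifted (suc i) (lookup L x)) (sym vacated)
                               (subst (λ ℓ → Shifted (suc i) ℓ 0) (sym ℓ≡1+i) shifted-at)
    where
    vacated : step s (suc i) x ≡ 0
    vacated with down x ℓ≡1+i
    ... | w , w⋖x , ℓw≡i = step-vacates 1+n≢0 sx≡1+i (w , w⋖x , proj₁ (proj₂ (shifted w)) ℓw≡i)
      where sx≡1+i = trans (proj₂ (proj₂ (shifted x)) (subst (i <_) (sym ℓ≡1+i) (n<1+n i))) ℓ≡1+i
  ... | tri> _ _ 1+i<ℓ = subst (Shifted (suc i) (lookup L x)) (sym kept) (shifted-above 1+i<ℓ)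
    where
    sx≡ℓ = proj₂ (proj₂ (shifted x)) (<-trans (n<1+n i) 1+i<ℓ)
    kept : step s (suc i) x ≡ lookup L x
    kept = trans (step-keeps {s} {suc i} {x} (λ sx≡0 → m<n⇒n≢0 1+i<ℓ (trans (sym sx≡ℓ) sx≡0))
                                             (λ sx≡1+i → <⇒≢ 1+i<ℓ (trans (sym sx≡1+i) sx≡ℓ)))
                 sx≡ℓ

  steps-shifted : ∀ q {i s} → (∀ j → i ≤ j → j < i + q → Slides j) →
                  ShiftedUpTo i s → ShiftedUpTo (i + q) (steps s (suc i) q)
  steps-shifted zero {i} {s} _ shifted = subst (λ j → ShiftedUpTo j s) (sym (+-identityʳ i)) shifted
  steps-shifted (suc q) {i} {s} slides shifted =
    subst (λ j → ShiftedUpTo j (steps (step s (suc i)) (suc (suc i)) q)) (sym (+-suc i q))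
          (steps-shifted q later (step-shifted (slides i ≤-refl i<i+1+q) shifted))
    where
    i<i+1+q : i < i + suc q
    i<i+1+q = subst (i <_) (sym (+-suc i q)) (s≤s (m≤m+n i q))
    later : ∀ j → suc i ≤ j → j < suc i + q → Slides j
    later j 1+i≤j j<1+i+q = slides j (≤-trans (n≤1+n i) 1+i≤j) (subst (j <_) (sym (+-suc i q)) j<1+i+q)

module DeleteDownSet {n n' : ℕ} (P : FinPoset n) (D : List (Fin n))
    (e : Fin n' → Fin n) (inj : ∀ {x y} → e x ≡ e y → x ≡ y)
    (image : ∀ z → (z ∉ D → ∃ λ x → e x ≡ z) × ((∃ λ x → e x ≡ z) → z ∉ D))
    (upward : ∀ {z u} → z ∉ D → _<P_ P z u → u ∉ D) where

  open import Data.List.Membership.DecPropositional (_≟ᶠ_ {n}) using (_∈?_)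

  Q : FinPoset n'
  Q = induced P e inj

  private
    module PP = Promotion P
    module PQ = Promotion Q

  e∉D : ∀ x → e x ∉ D
  e∉D x = proj₂ (image (e x)) (x , refl)

  preimage : ∀ {z} → z ∉ D → ∃ λ x → e x ≡ z
  preimage {z} = proj₁ (image z)

  <-embed : ∀ {x y} → _<P_ Q x y → _<P_ P (e x) (e y)
  <-embed (ex≤ey , x≢y) = ex≤ey , x≢y ∘ inj

  <-reflect : ∀ {x y} → _<P_ P (e x) (e y) → _<P_ Q x y
  <-reflect (ex≤ey , ex≢ey) = ex≤ey , ex≢ey ∘ cong e

  ⋖-embed : ∀ {x y} → _⋖_ Q x y → _⋖_ P (e x) (e y)
  ⋖-embed {x} {y} (x<y , nothing-between) = <-embed x<y , between
    where
    between : ¬ (∃ λ z → _<P_ P (e x) z × _<P_ P z (e y))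
    between (z , ex<z , z<ey) with preimage (upward (e∉D x) ex<z)
    ... | z' , refl = nothing-between (z' , <-reflect ex<z , <-reflect z<ey)

  ⋖-reflect : ∀ {x y} → _⋖_ P (e x) (e y) → _⋖_ Q x y
  ⋖-reflect (ex<ey , nothing-between) =
    <-reflect ex<ey , λ { (z , x<z , z<y) → nothing-between (e z , <-embed x<z , <-embed z<y) }

  module _ (t : ℕ) where

    Simulates : (Fin n → ℕ) → (Fin n' → ℕ) → Set
    Simulates s s' = (∀ z → z ∈ D → 0 < s z × s z ≤ suc t) × (∀ x → s (e x) ≡ shift t (s' x))

    step-image : ∀ {s s'} i → Simulates s s' → ∀ x →
                 PP.step s (suc i + t) (e x) ≡ shift t (PQ.step s' (suc i) x)
    step-image {s} {s'} i (band , sim) x =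
      trans (cong₂ (slide (s (e x)) (suc i + t)) (⌊⌋-⇔ fills⇔ _ _) (⌊⌋-⇔ vacates⇔ _ _))
            (trans (cong (λ v → slide v (suc i + t) _ _) (sim x)) (slide-shift t (s' x) i _ _))
      where
      fills⇔ : (∃ λ y → _⋖_ P (e x) y × s y ≡ suc i + t) ⇔ (∃ λ y → _⋖_ Q x y × s' y ≡ suc i)
      fills⇔ = mk⇔ to λ (y , x⋖y , s'y) → e y , ⋖-embed x⋖y , trans (sim y) (cong (shift t) s'y)
        where
        to : (∃ λ y → _⋖_ P (e x) y × s y ≡ suc i + t) → ∃ λ y → _⋖_ Q x y × s' y ≡ suc i
        to (y , ex⋖y , sy) with preimage (upward (e∉D x) (proj₁ ex⋖y))
        ... | y' , refl = y' , ⋖-reflect ex⋖y , shift≡+ (s' y') i (trans (sym (sim y')) sy)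

      vacates⇔ : (∃ λ w → _⋖_ P w (e x) × s w ≡ 0) ⇔ (∃ λ w → _⋖_ Q w x × s' w ≡ 0)
      vacates⇔ = mk⇔ to λ (w , w⋖x , s'w) → e w , ⋖-embed w⋖x , trans (sim w) (cong (shift t) s'w)
        where
        to : (∃ λ w → _⋖_ P w (e x) × s w ≡ 0) → ∃ λ w → _⋖_ Q w x × s' w ≡ 0
        to (w , w⋖ex , sw) with w ∈? D
        ... | yes w∈D = contradiction sw (n>0⇒n≢0 (proj₁ (band w w∈D)))
        ... | no w∉D with preimage w∉D
        ...   | w' , refl = w' , ⋖-reflect w⋖ex , shift≡0 (s' w') (trans (sym (sim w')) sw)

    simulates-step : ∀ {s s'} i → Simulates s s' →
                     Simulates (PP.step s (suc (suc i) + t)) (PQ.step s' (suc (suc i)))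
    simulates-step {s} {s'} i (band , sim) = band′ , step-image {s} {s'} (suc i) (band , sim)
      where
      band′ : ∀ z → z ∈ D → 0 < PP.step s (suc (suc i) + t) z × PP.step s (suc (suc i) + t) z ≤ suc t
      band′ z z∈D = subst (λ v → 0 < v × v ≤ suc t) (sym kept) (band z z∈D)
        where
        kept : PP.step s (suc (suc i) + t) z ≡ s z
        kept = PP.step-keeps {s} {suc (suc i) + t} {z}
                 (n>0⇒n≢0 (proj₁ (band z z∈D)))
                 (<⇒≢ (≤-<-trans (proj₂ (band z z∈D)) (s≤s (s≤s (m≤n+m t i)))))

    simulates-steps : ∀ q {i s s'} → Simulates s s' →
                      Simulates (PP.steps s (suc (suc i) + t) q) (PQ.steps s' (suc (suc i)) q)
    simulates-steps zero sim = sim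
    simulates-steps (suc q) {i} {s} {s'} sim = simulates-steps q (simulates-step {s} {s'} i sim)

module _ {n : ℕ} (P : FinPoset n) where

  -- c 0 ⋖ c 1 ⋖ ⋯ ⋖ c t, where c 0, …, c (t - 1) list T and each has the next one as its only
  -- cover; c t lies outside T (for T = [] it is the minimum itself).
  record IsChainEnumeration (T : List (Fin n)) (c : ℕ → Fin n) : Set where
    field
      covers : ∀ {k} → k < length T → _⋖_ P (c k) (c (suc k))
      only-cover : ∀ {k} → k < length T → ∀ {w} → _⋖_ P (c k) w → w ≡ c (suc k)
      member : ∀ {k} → k < length T → c k ∈ T
      position : ∀ {z} → z ∈ T → ∃ λ k → k < length T × c k ≡ z

  enumerate : ∀ {z} x xs → TrunkCandidate P z (x ∷ xs) → ℕ → Fin n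
  enumerate x xs candidate zero = x
  enumerate x [] (_ , top , _) (suc k) = top
  enumerate x (y ∷ xs) (_ , _ , _ , rest) (suc k) = enumerate y xs (refl , rest) k

  enumerate-isChainEnumeration : ∀ {z} x xs (candidate : TrunkCandidate P z (x ∷ xs)) →
                                 IsChainEnumeration (x ∷ xs) (enumerate x xs candidate)
  enumerate-isChainEnumeration x [] (_ , top , x⋖top , unique) = record
    { covers = λ { (s≤s z≤n) → x⋖top }
    ; only-cover = λ { (s≤s z≤n) x⋖w → unique _ x⋖w }
    ; member = λ { (s≤s z≤n) → here refl }
    ; position = λ { (here refl) → 0 , s≤s z≤n , refl ; (there ()) }
    }
  enumerate-isChainEnumeration x (y ∷ xs) candidate@(_ , (_ , _ , unique) , x⋖y , rest) = record
    { covers = covers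
    ; only-cover = only-cover
    ; member = member
    ; position = position
    }
    where
    module Tail = IsChainEnumeration (enumerate-isChainEnumeration y xs (refl , rest))
    c : ℕ → Fin n
    c = enumerate x (y ∷ xs) candidate

    covers : ∀ {k} → k < length (x ∷ y ∷ xs) → _⋖_ P (c k) (c (suc k))
    covers {zero} _ = x⋖y
    covers {suc k} (s≤s k<) = Tail.covers k<

    only-cover : ∀ {k} → k < length (x ∷ y ∷ xs) → ∀ {w} → _⋖_ P (c k) w → w ≡ c (suc k)
    only-cover {zero} _ x⋖w = trans (unique _ x⋖w) (sym (unique _ x⋖y))
    only-cover {suc k} (s≤s k<) = Tail.only-cover k<

    member : ∀ {k} → k < length (x ∷ y ∷ xs) → c k ∈ (x ∷ y ∷ xs)
    member {zero} _ = here refl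
    member {suc k} (s≤s k<) = there (Tail.member k<)

    position : ∀ {z} → z ∈ (x ∷ y ∷ xs) → ∃ λ k → k < length (x ∷ y ∷ xs) × c k ≡ z
    position (here refl) = 0 , s≤s z≤n , refl
    position (there z∈) with Tail.position z∈
    ... | k , k< , ck≡z = suc k , s≤s k< , ck≡z

  trunk-enumeration : ∀ {0̂} T → TrunkCandidate P 0̂ T →
                      Σ (ℕ → Fin n) λ c → c 0 ≡ 0̂ × IsChainEnumeration T c
  trunk-enumeration {0̂} [] _ = (λ _ → 0̂) , refl , record
    { covers = λ () ; only-cover = λ () ; member = λ () ; position = λ () }
  trunk-enumeration (x ∷ xs) candidate =
    enumerate x xs candidate , proj₁ candidate , enumerate-isChainEnumeration x xs candidate

module Trunk {n : ℕ} (P : FinPoset n) (0̂ : Fin n) (isMin : IsMinimum P 0̂)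
             (T : List (Fin n)) (c : ℕ → Fin n) (c0≡0̂ : c 0 ≡ 0̂)
             (chain : IsChainEnumeration P T c) where
  open FinPoset P
  open Order P
  open IsChainEnumeration chain

  t : ℕ
  t = length T

  -- Unique covers push everything not enumerated yet above the current chain element.
  enumerated-or-above : ∀ {k} → k ≤ t → ∀ z → (∃ λ j → j < k × c j ≡ z) ⊎ c k ≤P z
  enumerated-or-above {zero} _ z = inj₂ (subst (_≤P z) (sym c0≡0̂) (isMin z))
  enumerated-or-above {suc k} 1+k≤t z with enumerated-or-above (≤-trans (n≤1+n k) 1+k≤t) z
  ... | inj₁ (j , j<k , cj≡z) = inj₁ (j , m<n⇒m<1+n j<k , cj≡z)
  ... | inj₂ ck≤z with ≤P⇒≡⊎<P ck≤z
  ...   | inj₁ ck≡z = inj₁ (k , n<1+n k , ck≡z)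
  ...   | inj₂ ck<z with cover-below ck<z
  ...     | w , ck⋖w , w≤z = inj₂ (subst (_≤P z) (only-cover 1+k≤t ck⋖w) w≤z)

  c-strictMono : ∀ {i j} → i < j → j ≤ t → _<P_ P (c i) (c j)
  c-strictMono {i} {suc j} (s≤s i≤j) 1+j≤t with m≤n⇒m<n∨m≡n i≤j
  ... | inj₁ i<j = <P-trans (c-strictMono i<j (≤-trans (n≤1+n j) 1+j≤t)) (proj₁ (covers 1+j≤t))
  ... | inj₂ refl = proj₁ (covers 1+j≤t)

  c-mono : ∀ {i j} → i ≤ j → j ≤ t → c i ≤P c j
  c-mono i≤j j≤t with m≤n⇒m<n∨m≡n i≤j
  ... | inj₁ i<j = proj₁ (c-strictMono i<j j≤t)
  ... | inj₂ refl = reflP _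

  c-reflects-< : ∀ {i j} → i ≤ t → j ≤ t → _<P_ P (c i) (c j) → i < j
  c-reflects-< {i} {j} i≤t j≤t ci<cj with <-cmp i j
  ... | tri< i<j _ _ = i<j
  ... | tri≈ _ refl _ = contradiction refl (proj₂ ci<cj)
  ... | tri> _ _ j<i = contradiction refl (proj₂ (<P-trans ci<cj (c-strictMono j<i i≤t)))

  c-injective : ∀ {i j} → i ≤ t → j ≤ t → c i ≡ c j → i ≡ j
  c-injective {i} {j} i≤t j≤t ci≡cj with <-cmp i j
  ... | tri< i<j _ _ = contradiction ci≡cj (proj₂ (c-strictMono i<j j≤t))
  ... | tri≈ _ i≡j _ = i≡j
  ... | tri> _ _ j<i = contradiction (sym ci≡cj) (proj₂ (c-strictMono j<i i≤t))

  top∉T : c t ∉ T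
  top∉T ct∈T with position ct∈T
  ... | k , k<t , ck≡ct = <⇒≢ k<t (c-injective (<⇒≤ k<t) ≤-refl ck≡ct)

  above-top : ∀ {z} → z ∉ T → c t ≤P z
  above-top {z} z∉T with enumerated-or-above ≤-refl z
  ... | inj₁ (j , j<t , refl) = contradiction (member j<t) z∉T
  ... | inj₂ ct≤z = ct≤z

  ∉-upward : ∀ {z u} → z ∉ T → _<P_ P z u → u ∉ T
  ∉-upward z∉T z<u u∈T with position u∈T
  ... | k , k<t , refl = contradiction refl
        (proj₂ (≤P-<P-trans (above-top z∉T) (<P-trans z<u (c-strictMono k<t ≤-refl))))

  module Labels {m : ℕ} {L : Vec ℕ n} (packed : IsPacked P m L) where
    open Sliding P L using (Slides)

    private
      ℓ : Fin n → ℕ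
      ℓ = lookup L
      range = proj₁ packed
      onto = proj₁ (proj₂ packed)
      strict = proj₂ (proj₂ packed)

    ℓ-mono : ∀ {x y} → x ≤P y → ℓ x ≤ ℓ y
    ℓ-mono x≤y with ≤P⇒≡⊎<P x≤y
    ... | inj₁ refl = ≤-refl
    ... | inj₂ x<y = <⇒≤ (strict _ _ x<y)

    -- The label suc k is used, by an element enumerated before c k or lying above it.
    label-c-≤ : ∀ {k} → k ≤ t → (∀ {j} → j < k → ℓ (c j) ≤ k) → suc k ≤ ℓ (c k) → ℓ (c k) ≤ suc k
    label-c-≤ {k} k≤t earlier lower with onto (suc k) (s≤s z≤n) (≤-trans lower (proj₂ (range (c k))))
    ... | w , ℓw≡1+k with enumerated-or-above k≤t w
    ...   | inj₁ (j , j<k , refl) =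
      contradiction (earlier j<k) (subst (_≰ k) (sym ℓw≡1+k) (<-irrefl refl))
    ...   | inj₂ ck≤w = subst (ℓ (c k) ≤_) ℓw≡1+k (ℓ-mono ck≤w)

    label-c : ∀ k → k ≤ t → ℓ (c k) ≡ suc k
    label-c zero 0≤t = ≤-antisym (label-c-≤ 0≤t (λ ()) lower) lower
      where lower = proj₁ (range (c 0))
    label-c (suc k) k<t = ≤-antisym (label-c-≤ k<t earlier lower) lower
      where
      ℓck≡1+k = label-c k (<⇒≤ k<t)
      lower : suc (suc k) ≤ ℓ (c (suc k))
      lower = subst (_< ℓ (c (suc k))) ℓck≡1+k (strict _ _ (proj₁ (covers k<t)))
      earlier : ∀ {j} → j < suc k → ℓ (c j) ≤ suc k
      earlier j<1+k = subst (ℓ (c _) ≤_) ℓck≡1+k (ℓ-mono (c-mono (≤-pred j<1+k) (<⇒≤ k<t)))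

    label-∈ : ∀ {k z} → k < t → c k ≡ z → ℓ z ≡ suc k
    label-∈ k<t refl = label-c _ (<⇒≤ k<t)

    label-∉ : ∀ {z} → z ∉ T → t < ℓ z
    label-∉ z∉T = subst (_≤ ℓ _) (label-c t ≤-refl) (ℓ-mono (above-top z∉T))

    t<m : t < m
    t<m = subst (_≤ m) (label-c t ≤-refl) (proj₂ (range (c t)))

    label⁻¹ : ∀ {k x} → k ≤ t → ℓ x ≡ suc k → x ≡ c k
    label⁻¹ {k} {x} k≤t ℓx≡1+k with enumerated-or-above k≤t x
    ... | inj₁ (j , j<k , refl) =
      contradiction (suc-injective (trans (sym (label-∈ (<-≤-trans j<k k≤t) refl)) ℓx≡1+k)) (<⇒≢ j<k)
    ... | inj₂ ck≤x with ≤P⇒≡⊎<P ck≤x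
    ...   | inj₁ ck≡x = sym ck≡x
    ...   | inj₂ ck<x =
      contradiction (subst₂ _<_ (label-c k k≤t) ℓx≡1+k (strict _ _ ck<x)) (<-irrefl refl)

    slides : ∀ j → 1 ≤ j → j < suc t → Slides j
    slides (suc k) _ (s≤s k<t) = up , down
      where
      up : ∀ x → ℓ x ≡ suc k → ∃ λ y → _⋖_ P x y × ℓ y ≡ suc (suc k)
      up x ℓx≡1+k with label⁻¹ (<⇒≤ k<t) ℓx≡1+k
      ... | refl = c (suc k) , covers k<t , label-c (suc k) k<t
      down : ∀ y → ℓ y ≡ suc (suc k) → ∃ λ w → _⋖_ P w y × ℓ w ≡ suc k
      down y ℓy≡2+k with label⁻¹ k<t ℓy≡2+k
      ... | refl = c k , covers k<t , label-c k (<⇒≤ k<t)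

module Equivariance {n n' : ℕ} (P : FinPoset n) (0̂ : Fin n) (isMin : IsMinimum P 0̂)
    (T : List (Fin n)) (c : ℕ → Fin n) (c0≡0̂ : c 0 ≡ 0̂) (chain : IsChainEnumeration P T c)
    (e : Fin n' → Fin n) (inj : ∀ {x y} → e x ≡ e y → x ≡ y)
    (image : ∀ z → (z ∉ T → ∃ λ x → e x ≡ z) × ((∃ λ x → e x ≡ z) → z ∉ T))
    (m : ℕ) where

  open IsChainEnumeration chain
  open Trunk P 0̂ isMin T c c0≡0̂ chain
  open DeleteDownSet P T e inj image ∉-upward
  open import Data.List.Membership.DecPropositional (_≟ᶠ_ {n}) using (_∈?_)

  φ : Vec ℕ n → Vec ℕ n'
  φ L = tabulate (λ x → lookup L (e x) ∸ t)

  ψ-label : Vec ℕ n' → Fin n → ℕ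
  ψ-label L' z with z ∈? T
  ... | yes z∈T = suc (proj₁ (position z∈T))
  ... | no z∉T = lookup L' (proj₁ (preimage z∉T)) + t

  ψ : Vec ℕ n' → Vec ℕ n
  ψ L' = tabulate (ψ-label L')

  trunk-or-image : ∀ z → (∃ λ k → k < t × c k ≡ z) ⊎ (∃ λ x → e x ≡ z)
  trunk-or-image z with z ∈? T
  ... | yes z∈T = inj₁ (position z∈T)
  ... | no z∉T = inj₂ (preimage z∉T)

  φ-label : ∀ L x → lookup (φ L) x ≡ lookup L (e x) ∸ t
  φ-label L x = lookup∘tabulate _ x

  ψ-trunk : ∀ L' {k} → k < t → lookup (ψ L') (c k) ≡ suc k
  ψ-trunk L' {k} k<t = trans (lookup∘tabulate _ (c k)) ψ-label-c
    where
    ψ-label-c : ψ-label L' (c k) ≡ suc k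
    ψ-label-c with c k ∈? T
    ... | yes ck∈T = let (j , j<t , cj≡ck) = position ck∈T in
                     cong suc (c-injective (<⇒≤ j<t) (<⇒≤ k<t) cj≡ck)
    ... | no ck∉T = contradiction (member k<t) ck∉T

  ψ-image : ∀ L' x → lookup (ψ L') (e x) ≡ lookup L' x + t
  ψ-image L' x = trans (lookup∘tabulate _ (e x)) ψ-label-e
    where
    ψ-label-e : ψ-label L' (e x) ≡ lookup L' x + t
    ψ-label-e with e x ∈? T
    ... | yes ex∈T = contradiction ex∈T (e∉D x)
    ... | no ex∉T = cong (λ y → lookup L' y + t) (inj (proj₂ (preimage ex∉T)))

  φ-packed : ∀ L → IsPacked P m L → IsPacked Q (m ∸ t) (φ L)
  φ-packed L packed = range′ , onto′ , strict′
    where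
    open Labels {m} {L} packed
    range = proj₁ packed

    range′ : ∀ x → 1 ≤ lookup (φ L) x × lookup (φ L) x ≤ m ∸ t
    range′ x = subst (λ v → 1 ≤ v × v ≤ m ∸ t) (sym (φ-label L x))
                     (m<n⇒0<n∸m (label-∉ (e∉D x)) , ∸-monoˡ-≤ t (proj₂ (range (e x))))

    onto′ : ∀ k → 1 ≤ k → k ≤ m ∸ t → ∃ λ x → lookup (φ L) x ≡ k
    onto′ k 1≤k k≤m∸t with proj₁ (proj₂ packed) (k + t) (≤-trans 1≤k (m≤m+n k t))
                             (subst (k + t ≤_) (m∸n+n≡m (<⇒≤ t<m)) (+-monoˡ-≤ t k≤m∸t))
    ... | z , ℓz≡k+t with trunk-or-image z
    ...   | inj₁ (j , j<t , cj≡z) =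
      contradiction (subst (_≤ t) (trans (sym (label-∈ j<t cj≡z)) ℓz≡k+t) j<t) (<⇒≱ (+-monoˡ-≤ t 1≤k))
    ...   | inj₂ (x , refl) = x , trans (φ-label L x) (trans (cong (_∸ t) ℓz≡k+t) (m+n∸n≡m k t))

    strict′ : ∀ x y → _<P_ Q x y → lookup (φ L) x < lookup (φ L) y
    strict′ x y x<y = subst₂ _<_ (sym (φ-label L x)) (sym (φ-label L y))
      (∸-monoˡ-< (proj₂ (proj₂ packed) _ _ (<-embed x<y)) (<⇒≤ (label-∉ (e∉D x))))

  ψ-packed : ∀ L' → IsPacked Q (m ∸ t) L' → IsPacked P m (ψ L')
  ψ-packed L' packed = range′ , onto′ , strict′
    where
    range = proj₁ packed

    t<m : t < m
    t<m with preimage top∉T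
    ... | x , _ = m∸n≢0⇒n<m (n>0⇒n≢0 (≤-trans (proj₁ (range x)) (proj₂ (range x))))

    range′ : ∀ z → 1 ≤ lookup (ψ L') z × lookup (ψ L') z ≤ m
    range′ z with trunk-or-image z
    ... | inj₁ (k , k<t , refl) = subst (λ v → 1 ≤ v × v ≤ m) (sym (ψ-trunk L' k<t))
                                        (s≤s z≤n , ≤-trans k<t (<⇒≤ t<m))
    ... | inj₂ (x , refl) = subst (λ v → 1 ≤ v × v ≤ m) (sym (ψ-image L' x))
      ( ≤-trans (proj₁ (range x)) (m≤m+n _ t)
      , subst (lookup L' x + t ≤_) (m∸n+n≡m (<⇒≤ t<m)) (+-monoˡ-≤ t (proj₂ (range x))))

    onto′ : ∀ k → 1 ≤ k → k ≤ m → ∃ λ z → lookup (ψ L') z ≡ k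
    onto′ k 1≤k k≤m with k ≤? t
    onto′ (suc k) _ _ | yes k<t = c k , ψ-trunk L' k<t
    ... | no k≰t with proj₁ (proj₂ packed) (k ∸ t) (m<n⇒0<n∸m (≰⇒> k≰t)) (∸-monoˡ-≤ t k≤m)
    ...   | x , L'x≡k∸t =
      e x , trans (ψ-image L' x) (trans (cong (_+ t) L'x≡k∸t) (m∸n+n≡m (<⇒≤ (≰⇒> k≰t))))

    strict′ : ∀ z z′ → _<P_ P z z′ → lookup (ψ L') z < lookup (ψ L') z′
    strict′ z z′ z<z′ with trunk-or-image z | trunk-or-image z′
    ... | inj₁ (j , j<t , refl) | inj₁ (k , k<t , refl) =
      subst₂ _<_ (sym (ψ-trunk L' j<t)) (sym (ψ-trunk L' k<t))
             (s≤s (c-reflects-< (<⇒≤ j<t) (<⇒≤ k<t) z<z′))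
    ... | inj₁ (j , j<t , refl) | inj₂ (x′ , refl) =
      subst₂ _<_ (sym (ψ-trunk L' j<t)) (sym (ψ-image L' x′))
             (≤-trans (s≤s j<t) (+-monoˡ-≤ t (proj₁ (range x′))))
    ... | inj₂ (x , refl) | inj₁ (k , k<t , refl) =
      contradiction (member k<t) (∉-upward (e∉D x) z<z′)
    ... | inj₂ (x , refl) | inj₂ (x′ , refl) =
      subst₂ _<_ (sym (ψ-image L' x)) (sym (ψ-image L' x′))
             (+-monoˡ-< t (proj₂ (proj₂ packed) _ _ (<-reflect z<z′)))

  ψ∘φ : ∀ L → IsPacked P m L → ψ (φ L) ≡ L
  ψ∘φ L packed = Pointwise-≡⇒≡ (ext same-label)
    where
    open Labels {m} {L} packed
    same-label : ∀ z → lookup (ψ (φ L)) z ≡ lookup L z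
    same-label z with trunk-or-image z
    ... | inj₁ (k , k<t , refl) = trans (ψ-trunk (φ L) k<t) (sym (label-∈ k<t refl))
    ... | inj₂ (x , refl) = trans (ψ-image (φ L) x)
      (trans (cong (_+ t) (φ-label L x)) (m∸n+n≡m (<⇒≤ (label-∉ (e∉D x)))))

  φ∘ψ : ∀ L' → φ (ψ L') ≡ L'
  φ∘ψ L' = Pointwise-≡⇒≡ (ext λ x →
    trans (φ-label (ψ L') x) (trans (cong (_∸ t) (ψ-image L' x)) (m+n∸n≡m _ t)))

  private
    module PP = Promotion P
    module PQ = Promotion Q

  promotion-simulates : ∀ L → IsPacked P m L →
    Simulates t (PP.steps (PP.initial L) 2 (m ∸ 1)) (PQ.steps (PQ.initial (φ L)) 2 ((m ∸ t) ∸ 1))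
  promotion-simulates L packed =
    subst₂ (Simulates t) (sym splitP) (sym splitQ) (simulates-steps t q (handoff trunk-phase))
    where
    open Labels {m} {L} packed
    open Sliding P L using (ShiftedUpTo; initial-shifted; steps-shifted)

    q = (m ∸ 1) ∸ t
    s₁ = PP.steps (PP.initial L) 2 t

    splitP : PP.steps (PP.initial L) 2 (m ∸ 1) ≡ PP.steps s₁ (2 + t) q
    splitP = trans (cong (PP.steps (PP.initial L) 2) (sym (m+[n∸m]≡n (∸-monoˡ-≤ 1 t<m))))
                   (PP.steps-+ (PP.initial L) 2 t q)

    splitQ : PQ.steps (PQ.initial (φ L)) 2 ((m ∸ t) ∸ 1) ≡ PQ.steps (PQ.initial (φ L)) 2 q
    splitQ = cong (PQ.steps (PQ.initial (φ L)) 2)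
                  (trans (∸-+-assoc m t 1) (trans (cong (m ∸_) (+-comm t 1)) (sym (∸-+-assoc m 1 t))))

    trunk-phase : ShiftedUpTo (suc t) s₁
    trunk-phase = steps-shifted t slides (initial-shifted (λ x → proj₁ (proj₁ packed x)))

    handoff : ∀ {s} → ShiftedUpTo (suc t) s → Simulates t s (PQ.initial (φ L))
    handoff {s} shifted = band , image-state
      where
      band : ∀ z → z ∈ T → 0 < s z × s z ≤ suc t
      band z z∈T with position z∈T
      ... | k , k<t , refl = subst (λ v → 0 < v × v ≤ suc t) (sym sck≡2+k) (s≤s z≤n , s≤s k<t)
        where
        ℓck≡1+k = label-∈ k<t refl
        sck≡2+k : s (c k) ≡ suc (suc k)
        sck≡2+k = trans (proj₁ (shifted (c k)) (subst (_< suc t) (sym ℓck≡1+k) (s≤s k<t)))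
                        (cong suc ℓck≡1+k)

      offset-state : ∀ x u → u + t ≡ lookup L (e x) → s (e x) ≡ shift t (erase-one u)
      offset-state x zero t≡ℓ = contradiction (subst (t <_) (sym t≡ℓ) (label-∉ (e∉D x))) (<-irrefl refl)
      offset-state x (suc zero) 1+t≡ℓ = proj₁ (proj₂ (shifted (e x))) (sym 1+t≡ℓ)
      offset-state x (suc (suc u)) 2+u+t≡ℓ =
        trans (proj₂ (proj₂ (shifted (e x))) (subst (suc t <_) 2+u+t≡ℓ (s≤s (s≤s (m≤n+m t u)))))
              (sym 2+u+t≡ℓ)

      image-state : ∀ x → s (e x) ≡ shift t (PQ.initial (φ L) x)
      image-state x =
        trans (offset-state x (lookup L (e x) ∸ t) (m∸n+n≡m (<⇒≤ (label-∉ (e∉D x)))))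
              (cong (shift t ∘ erase-one) (sym (φ-label L x)))

  φ-commutes : ∀ L → IsPacked P m L → ∂K Q (m ∸ t) (φ L) ≡ φ (∂K P m L)
  φ-commutes L packed = begin
    ∂K Q (m ∸ t) (φ L)                        ≡⟨ PQ.∂K-steps (m ∸ t) (φ L) ⟩
    tabulate (λ x → finish (m ∸ t) (sQ x))    ≡⟨ tabulate-cong finish-image ⟩
    tabulate (λ x → finish m (sP (e x)) ∸ t)
      ≡⟨ tabulate-cong (λ x → cong (_∸ t) (lookup∘tabulate _ (e x))) ⟨
    φ (tabulate (λ z → finish m (sP z)))      ≡⟨ cong φ (PP.∂K-steps m L) ⟨
    φ (∂K P m L)                              ∎
    where
    open ≡-Reasoning
    sP = PP.steps (PP.initial L) 2 (m ∸ 1)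
    sQ = PQ.steps (PQ.initial (φ L)) 2 ((m ∸ t) ∸ 1)
    finish-image : ∀ x → finish (m ∸ t) (sQ x) ≡ finish m (sP (e x)) ∸ t
    finish-image x = trans (finish-shift m t (sQ x))
                           (cong (λ v → finish m v ∸ t) (sym (proj₂ (promotion-simulates L packed) x)))

proposition2p3 : ∀ {n : ℕ} (P : FinPoset n) (0̂ : Fin n) → IsMinimum P 0̂ →
    (m : ℕ) → 1 ≤ m →
    (T : List (Fin n)) → IsTrunk P 0̂ T →
    ∀ {n' : ℕ} (e : Fin n' → Fin n) (inj : ∀ {x y} → e x ≡ e y → x ≡ y) →
    (∀ z → (z ∉ T → ∃ λ x → e x ≡ z) × ((∃ λ x → e x ≡ z) → z ∉ T)) →
    Σ (Vec ℕ n → Vec ℕ n') λ φ → Σ (Vec ℕ n' → Vec ℕ n) λ ψ →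
        (∀ L → IsPacked P m L → IsPacked (induced P e inj) (m ∸ length T) (φ L))
      × (∀ L' → IsPacked (induced P e inj) (m ∸ length T) L' → IsPacked P m (ψ L'))
      × (∀ L → IsPacked P m L → ψ (φ L) ≡ L)
      × (∀ L' → IsPacked (induced P e inj) (m ∸ length T) L' → φ (ψ L') ≡ L')
      × (∀ L → IsPacked P m L →
           ∂K (induced P e inj) (m ∸ length T) (φ L) ≡ φ (∂K P m L))
proposition2p3 P 0̂ isMin m _ T (candidate , _) e inj image
  with trunk-enumeration P T candidate
... | c , c0≡0̂ , chain = φ , ψ , φ-packed , ψ-packed , ψ∘φ , (λ L' _ → φ∘ψ L') , φ-commutes
  where open Equivariance P 0̂ isMin T c c0≡0̂ chain e inj image m
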